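{- Let $a,b$ be integers with $b\ge 2a$ and let $\mathcal{C}$ be the minor-closed class of matroids whose set of excluded minors is $\{U_{a,b},U_{b-a,b}\}$. Let $k\ge 2(b-a)$ and let $(\{e\},\rho)$ be a $k$-polymatroid on a one-element ground set, of rank $m=\rho(\{e\})$. (1) If $m\in[0,a-1]\cup[k-a+1,k]$, then $\rho\in\mathcal{C}_k$, and hence $\rho$ is not an excluded minor for $\mathcal{C}_k$. (2) If $m\in[a,k-a]$, then $\rho\in Ex(\mathcal{C}_k)$. Consequently there are exactly $k-2a+1$ excluded minors for $\mathcal{C}_k$ on a one-element ground set (up to isomorphism).
   Context: A polymatroid $(E,\rho)$ consists of a finite set $E$ and $\rho: 2^E \to \mathbb{Z}_{\geq 0}$ with $\rho(\emptyset)=0$, monotone and submodular; it is a $k$-polymatroid if $\rho(\{e\})\le k$ for all $e\in E$. Deletion $\rho\backslash A$ is the restriction to subsets of $E-A$; contraction $\rho/A$ is the polymatroid on $E-A$ with $(\rho/A)(X)=\rho(X\cup A)-\rho(A)$; minors are obtained by sequences of these, and are proper if the ground set shrinks. The $k$-natural matroid $M_\rho^k$: for each $e\in E$ take a set $X_e$ of $k$ new elements (pairwise disjoint); the ground set is $\bigcup_e X_e$ and the rank of $Z$ is $\min_{A\subseteq E}\big(\rho(A)+|Z-\bigcup_{e\in A}X_e|\big)$. $\mathcal{C}_k$ is the class of $k$-polymatroids whose $k$-natural matroid is in $\mathcal{C}$, and $Ex(\mathcal{C}_k)$ is the set of $k$-polymatroids not in $\mathcal{C}_k$ all of whose proper minors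 lie in $\mathcal{C}_k$. $U_{r,n}$ denotes the uniform matroid of rank $r$ on $n$ elements. -}

module Defs where

open import Data.Nat using (ℕ; zero; suc; _+_; _*_; _∸_; _≤_; _<_; _⊓_)
open import Data.Fin using (Fin; remQuot)
open import Data.Fin.Subset using (Subset; ⊥; ⁅_⁆; ∣_∣; _⊆_; _∪_; _∩_; ∁; inside; outside)
open import Data.Fin.Permutation using (Permutation′; _⟨$⟩ˡ_)
open import Data.Vec using (Vec; []; _∷_; insertAt; lookup; tabulate)
open import Data.Product using (Σ; _×_; proj₁)
open import Relation.Binary.PropositionalEquality using (_≡_)
open import Relation.Nullary using (¬_)

SetFn : ℕ → Set
SetFn n = Subset n → ℕ

record IsPolymatroid {n : ℕ} (ρ : SetFn n) : Set where
  field
    normalized : ρ ⊥ ≡ 0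
    monotone   : ∀ X Y → X ⊆ Y → ρ X ≤ ρ Y
    submodular : ∀ X Y → ρ (X ∪ Y) + ρ (X ∩ Y) ≤ ρ X + ρ Y

IsKPolymatroid : ℕ → {n : ℕ} → SetFn n → Set
IsKPolymatroid k {n} ρ = IsPolymatroid ρ × (∀ (e : Fin n) → ρ ⁅ e ⁆ ≤ k)

record IsMatroid {n : ℕ} (r : SetFn n) : Set where
  field
    bounded    : ∀ X → r X ≤ ∣ X ∣
    monotone   : ∀ X Y → X ⊆ Y → r X ≤ r Y
    submodular : ∀ X Y → r (X ∪ Y) + r (X ∩ Y) ≤ r X + r Y

delete : {n : ℕ} → Fin (suc n) → SetFn (suc n) → SetFn n
delete e ρ X = ρ (insertAt X e outside)

contract : {n : ℕ} → Fin (suc n) → SetFn (suc n) → SetFn n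
contract e ρ X = ρ (insertAt X e inside) ∸ ρ ⁅ e ⁆

-- IsMinor N M : N is obtained from M by a sequence of deletions and contractions
-- (deleting/contracting a set = deleting/contracting its elements one at a time).
data IsMinor : {m n : ℕ} → SetFn m → SetFn n → Set where
  same : {n : ℕ} {N M : SetFn n} → (∀ X → N X ≡ M X) → IsMinor N M
  del  : {m n : ℕ} {N : SetFn m} {M : SetFn (suc n)} (e : Fin (suc n)) →
         IsMinor N (delete e M) → IsMinor N M
  con  : {m n : ℕ} {N : SetFn m} {M : SetFn (suc n)} (e : Fin (suc n)) →
         IsMinor N (contract e M) → IsMinor N M

IsProperMinor : {m n : ℕ} → SetFn m → SetFn n → Set
IsProperMinor {m} {n} N M = IsMinor N M × m < n

image : {n : ℕ} → Permutation′ n → Subset n → Subset n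
image π X = tabulate (λ j → lookup X (π ⟨$⟩ˡ j))

Isomorphic : {n : ℕ} → SetFn n → SetFn n → Set
Isomorphic {n} N M = Σ (Permutation′ n) (λ π → ∀ X → M (image π X) ≡ N X)

U : (r n : ℕ) → SetFn n
U r n X = ∣ X ∣ ⊓ r

HasMinorIso : {m n : ℕ} → SetFn n → SetFn m → Set
HasMinorIso {m} M N = Σ (SetFn m) (λ L → IsMinor L M × Isomorphic L N)

InC : (a b : ℕ) → {n : ℕ} → SetFn n → Set
InC a b M = IsMatroid M × ¬ HasMinorIso M (U a b) × ¬ HasMinorIso M (U (b ∸ a) b)

minSub : {n : ℕ} → (Subset n → ℕ) → ℕ
minSub {zero} f = f []
minSub {suc n} f = minSub (λ X → f (outside ∷ X)) ⊓ minSub (λ X → f (inside ∷ X))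

-- k-natural matroid: ground set Fin (n * k), element z lies in X_e where
-- e = proj₁ (remQuot k z) (so X_e are the n pairwise disjoint blocks of size k).
blowUp : (k : ℕ) → {n : ℕ} → Subset n → Subset (n * k)
blowUp k A = tabulate (λ z → lookup A (proj₁ (remQuot k z)))

naturalMatroid : (k : ℕ) → {n : ℕ} → SetFn n → SetFn (n * k)
naturalMatroid k ρ Z = minSub (λ A → ρ A + ∣ Z ∩ ∁ (blowUp k A) ∣)

InCk : (a b k : ℕ) → {n : ℕ} → SetFn n → Set
InCk a b k ρ = IsKPolymatroid k ρ × InC a b (naturalMatroid k ρ)

IsExcluded : (a b k : ℕ) → {n : ℕ} → SetFn n → Set
IsExcluded a b k {n} ρ =
  IsKPolymatroid k ρ × ¬ InCk a b k ρ ×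
  (∀ {m : ℕ} (N : SetFn m) → IsProperMinor N ρ → InCk a b k N)

{-# OPTIONS --safe #-}

-- On a one-element ground set the k-natural matroid of ρ is the uniform matroid
-- U_{m,k} with m = ρ({e}). Rank ≤ c and dual rank ≤ c are minor-closed, while U_{r,b}
-- has rank r and dual rank b − r; hence U_{m,k} has neither U_{a,b} nor U_{b−a,b} as a
-- minor when m < a or k − m < a. When a ≤ m ≤ k − a, contracting and deleting elements
-- of U_{m,k} produces U_{b−a,b} if m ≥ b − a and U_{a,b} otherwise (the latter uses
-- k ≥ 2(b − a)). Every proper minor of a one-element polymatroid lives on the empty set,
-- where membership in 𝒞_k is trivial; so the excluded minors are the polymatroids with
-- m ∈ [a, k − a], one isomorphism class for each m.
module Submission where

open import Defs
open import Data.Nat using (ℕ; zero; suc; _+_; _*_; _∸_; _≤_; _<_; _⊓_; z≤n; s≤s; _<?_; _≤?_)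
open import Data.Nat.Properties
open import Data.Fin using (Fin; zero; suc; toℕ; fromℕ<; remQuot)
open import Data.Fin.Properties using (toℕ<n; toℕ-injective; toℕ-fromℕ<)
open import Data.Fin.Subset using (Subset; Side; ⊥; ⊤; ⁅_⁆; ∣_∣; _⊆_; _∪_; _∩_; ∁; inside; outside)
open import Data.Fin.Subset.Properties
  using (∣⊤∣≡n; ∣⊥∣≡0; p⊆q⇒∣p∣≤∣q∣; ∣p∩q∣≤∣p∣; ∣p∩q∣≤∣q∣; ∣p∣≤∣p∪q∣; ∣q∣≤∣p∪q∣; ∣p∣≤n;
         ⊥⊆; drop-∷-⊆; out⊆; in⊆in; s⊆s; ∩-identityʳ; ∩-zeroʳ)
open import Data.Fin.Permutation using (Permutation′; _⟨$⟩ˡ_) renaming (id to idₚ)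
open import Data.Vec using ([]; _∷_; insertAt; lookup; tabulate; replicate; here)
open import Data.Vec.Properties using (tabulate-cong; tabulate∘lookup; lookup-replicate; map-replicate)
open import Data.Product using (Σ; _×_; _,_; proj₁; proj₂)
open import Data.Sum using (_⊎_; inj₁; inj₂)
open import Relation.Binary.PropositionalEquality
  using (_≡_; refl; sym; trans; cong; cong₂; subst; subst₂; _≗_; module ≡-Reasoning)
open import Relation.Nullary using (¬_; yes; no)
open import Data.Empty using (⊥-elim)
open import Data.Bool using (not)
open import Function using (case_of_)

∣p∪q∣+∣p∩q∣≡∣p∣+∣q∣ : ∀ {n} (p q : Subset n) → ∣ p ∪ q ∣ + ∣ p ∩ q ∣ ≡ ∣ p ∣ + ∣ q ∣
∣p∪q∣+∣p∩q∣≡∣p∣+∣q∣ [] [] = refl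
∣p∪q∣+∣p∩q∣≡∣p∣+∣q∣ (outside ∷ p) (outside ∷ q) = ∣p∪q∣+∣p∩q∣≡∣p∣+∣q∣ p q
∣p∪q∣+∣p∩q∣≡∣p∣+∣q∣ (outside ∷ p) (inside ∷ q) =
  trans (cong suc (∣p∪q∣+∣p∩q∣≡∣p∣+∣q∣ p q)) (sym (+-suc ∣ p ∣ ∣ q ∣))
∣p∪q∣+∣p∩q∣≡∣p∣+∣q∣ (inside ∷ p) (outside ∷ q) = cong suc (∣p∪q∣+∣p∩q∣≡∣p∣+∣q∣ p q)
∣p∪q∣+∣p∩q∣≡∣p∣+∣q∣ (inside ∷ p) (inside ∷ q) =
  cong suc (trans (+-suc ∣ p ∪ q ∣ ∣ p ∩ q ∣) (trans (cong suc (∣p∪q∣+∣p∩q∣≡∣p∣+∣q∣ p q)) (sym (+-suc ∣ p ∣ ∣ q ∣))))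

∣insertAt-outside∣≡∣p∣ : ∀ {n} (p : Subset n) i → ∣ insertAt p i outside ∣ ≡ ∣ p ∣
∣insertAt-outside∣≡∣p∣ p zero = refl
∣insertAt-outside∣≡∣p∣ (inside ∷ p) (suc i) = cong suc (∣insertAt-outside∣≡∣p∣ p i)
∣insertAt-outside∣≡∣p∣ (outside ∷ p) (suc i) = ∣insertAt-outside∣≡∣p∣ p i

∣insertAt-inside∣≡1+∣p∣ : ∀ {n} (p : Subset n) i → ∣ insertAt p i inside ∣ ≡ suc ∣ p ∣
∣insertAt-inside∣≡1+∣p∣ p zero = refl
∣insertAt-inside∣≡1+∣p∣ (inside ∷ p) (suc i) = cong suc (∣insertAt-inside∣≡1+∣p∣ p i)
∣insertAt-inside∣≡1+∣p∣ (outside ∷ p) (suc i) = ∣insertAt-inside∣≡1+∣p∣ p i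

insertAt-mono-⊆ : ∀ {n} {p q : Subset n} i (s : Side) → p ⊆ q → insertAt p i s ⊆ insertAt q i s
insertAt-mono-⊆ zero s p⊆q = s⊆s p⊆q
insertAt-mono-⊆ {p = outside ∷ p} {_ ∷ q} (suc i) s p⊆q = out⊆ (insertAt-mono-⊆ i s (drop-∷-⊆ p⊆q))
insertAt-mono-⊆ {p = inside ∷ p} {_ ∷ q} (suc i) s p⊆q with p⊆q here
... | here = in⊆in (insertAt-mono-⊆ i s (drop-∷-⊆ p⊆q))

⁅i⁆⊆insertAt-inside : ∀ {n} (p : Subset n) i → ⁅ i ⁆ ⊆ insertAt p i inside
⁅i⁆⊆insertAt-inside p zero = in⊆in ⊥⊆
⁅i⁆⊆insertAt-inside (_ ∷ p) (suc i) = out⊆ (⁅i⁆⊆insertAt-inside p i)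

tabulate-lookup-replicate : ∀ {A : Set} {m n} (f : Fin m → Fin n) (x : A) →
  tabulate (λ j → lookup (replicate n x) (f j)) ≡ replicate m x
tabulate-lookup-replicate {m = m} f x = begin
  tabulate (λ j → lookup (replicate _ x) (f j)) ≡⟨ tabulate-cong (λ j → trans (lookup-replicate (f j) x) (sym (lookup-replicate j x))) ⟩
  tabulate (lookup (replicate m x))             ≡⟨ tabulate∘lookup (replicate m x) ⟩
  replicate m x                                 ∎
  where open ≡-Reasoning

image-replicate : ∀ {n} (π : Permutation′ n) (s : Side) → image π (replicate n s) ≡ replicate n s
image-replicate π = tabulate-lookup-replicate (π ⟨$⟩ˡ_)

⊓-concave : ∀ r {u i s t} → u + i ≡ s + t → i ≤ s → i ≤ t → s ≤ u → t ≤ u →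
  u ⊓ r + i ⊓ r ≤ s ⊓ r + t ⊓ r
⊓-concave r {u} {i} {s} {t} eq i≤s i≤t s≤u t≤u with u ≤? r | r ≤? s | r ≤? t
... | yes u≤r | _ | _
  rewrite m≤n⇒m⊓n≡m u≤r | m≤n⇒m⊓n≡m (≤-trans (≤-trans i≤s s≤u) u≤r)
        | m≤n⇒m⊓n≡m (≤-trans s≤u u≤r) | m≤n⇒m⊓n≡m (≤-trans t≤u u≤r) = ≤-reflexive eq
... | no u≰r | yes r≤s | _
  rewrite m≥n⇒m⊓n≡n (<⇒≤ (≰⇒> u≰r)) | m≥n⇒m⊓n≡n r≤s = +-monoʳ-≤ r (⊓-monoˡ-≤ r i≤t)
... | no u≰r | no _ | yes r≤t
  rewrite m≥n⇒m⊓n≡n (<⇒≤ (≰⇒> u≰r)) | m≥n⇒m⊓n≡n r≤t =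
  ≤-trans (≤-reflexive (+-comm r (i ⊓ r))) (+-monoˡ-≤ r (⊓-monoˡ-≤ r i≤s))
... | no u≰r | no r≰s | no r≰t
  rewrite m≥n⇒m⊓n≡n (<⇒≤ (≰⇒> u≰r)) | m≤n⇒m⊓n≡m (<⇒≤ (≰⇒> r≰s)) | m≤n⇒m⊓n≡m (<⇒≤ (≰⇒> r≰t)) =
  ≤-trans (+-mono-≤ (<⇒≤ (≰⇒> u≰r)) (m⊓n≤m i r)) (≤-reflexive eq)

⊓-nullity-bound : ∀ m n {x y} → x ≤ y → y ≤ n → y ∸ x ≤ (y ⊓ m ∸ x ⊓ m) + (n ∸ m)
⊓-nullity-bound m n {x} {y} x≤y y≤n with y ≤? m | m ≤? x
... | yes y≤m | _ rewrite m≤n⇒m⊓n≡m y≤m | m≤n⇒m⊓n≡m (≤-trans x≤y y≤m) = m≤m+n (y ∸ x) (n ∸ m)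
... | no y≰m | yes m≤x rewrite m≥n⇒m⊓n≡n (<⇒≤ (≰⇒> y≰m)) | m≥n⇒m⊓n≡n m≤x | n∸n≡0 m = ∸-mono y≤n m≤x
... | no y≰m | no m≰x rewrite m≥n⇒m⊓n≡n (<⇒≤ (≰⇒> y≰m)) | m≤n⇒m⊓n≡m (<⇒≤ (≰⇒> m≰x)) =
  m≤n+o⇒m∸n≤o y x (≤-trans y≤n (≤-reflexive (sym x+[m∸x+n∸m]≡n)))
  where
  x≤m : x ≤ m
  x≤m = <⇒≤ (≰⇒> m≰x)
  x+[m∸x+n∸m]≡n : x + ((m ∸ x) + (n ∸ m)) ≡ n
  x+[m∸x+n∸m]≡n = trans (sym (+-assoc x (m ∸ x) (n ∸ m)))
    (trans (cong (_+ (n ∸ m)) (m+[n∸m]≡n x≤m)) (m+[n∸m]≡n (≤-trans (<⇒≤ (≰⇒> y≰m)) y≤n)))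

U-isMatroid : ∀ r n → IsMatroid (U r n)
U-isMatroid r n = record
  { bounded    = λ X → m⊓n≤m ∣ X ∣ r
  ; monotone   = λ X Y X⊆Y → ⊓-monoˡ-≤ r (p⊆q⇒∣p∣≤∣q∣ X⊆Y)
  ; submodular = λ X Y → ⊓-concave r (∣p∪q∣+∣p∩q∣≡∣p∣+∣q∣ X Y)
      (∣p∩q∣≤∣p∣ X Y) (∣p∩q∣≤∣q∣ X Y) (∣p∣≤∣p∪q∣ X Y) (∣q∣≤∣p∪q∣ X Y)
  }

IsMatroid-resp : ∀ {n} {M M′ : SetFn n} → M ≗ M′ → IsMatroid M → IsMatroid M′
IsMatroid-resp {M = M} {M′} M≗M′ isM = record
  { bounded    = λ X → subst (_≤ ∣ X ∣) (M≗M′ X) (bounded X)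
  ; monotone   = λ X Y X⊆Y → subst₂ _≤_ (M≗M′ X) (M≗M′ Y) (monotone X Y X⊆Y)
  ; submodular = λ X Y → subst₂ _≤_ (cong₂ _+_ (M≗M′ (X ∪ Y)) (M≗M′ (X ∩ Y)))
                                    (cong₂ _+_ (M≗M′ X) (M≗M′ Y)) (submodular X Y)
  }
  where open IsMatroid isM

IsMinor-respʳ : ∀ {m n} {N : SetFn m} {M M′ : SetFn n} → IsMinor N M → M ≗ M′ → IsMinor N M′
IsMinor-respʳ (same N≗M) M≗M′ = same (λ X → trans (N≗M X) (M≗M′ X))
IsMinor-respʳ (del e N≼M) M≗M′ = del e (IsMinor-respʳ N≼M (λ X → M≗M′ (insertAt X e outside)))
IsMinor-respʳ (con e N≼M) M≗M′ = con e (IsMinor-respʳ N≼M (λ X → cong₂ _∸_ (M≗M′ _) (M≗M′ ⁅ e ⁆)))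

IsMinor-trans : ∀ {l m n} {N : SetFn l} {L : SetFn m} {M : SetFn n} →
  IsMinor N L → IsMinor L M → IsMinor N M
IsMinor-trans N≼L (same L≗M) = IsMinor-respʳ N≼L L≗M
IsMinor-trans N≼L (del e L≼M) = del e (IsMinor-trans N≼L L≼M)
IsMinor-trans N≼L (con e L≼M) = con e (IsMinor-trans N≼L L≼M)

IsMinor⇒≤ : ∀ {m n} {N : SetFn m} {M : SetFn n} → IsMinor N M → m ≤ n
IsMinor⇒≤ (same _) = ≤-refl
IsMinor⇒≤ (del _ N≼M) = m≤n⇒m≤1+n (IsMinor⇒≤ N≼M)
IsMinor⇒≤ (con _ N≼M) = m≤n⇒m≤1+n (IsMinor⇒≤ N≼M)

MinorClosed : (∀ {n} → SetFn n → Set) → Set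
MinorClosed P = ∀ {m n} {N : SetFn m} {M : SetFn n} → IsMinor N M → P M → P N

minorClosed : (P : ∀ {n} → SetFn n → Set) →
  (∀ {n} {M M′ : SetFn n} → M ≗ M′ → P M → P M′) →
  (∀ {n} (e : Fin (suc n)) M → P M → P (delete e M)) →
  (∀ {n} (e : Fin (suc n)) M → P M → P (contract e M)) →
  MinorClosed P
minorClosed P resp pdel pcon (same N≗M) PM = resp (λ X → sym (N≗M X)) PM
minorClosed P resp pdel pcon (del e N≼M) PM = minorClosed P resp pdel pcon N≼M (pdel e _ PM)
minorClosed P resp pdel pcon (con e N≼M) PM = minorClosed P resp pdel pcon N≼M (pcon e _ PM)

contract-U : ∀ r n → contract zero (U (suc r) (suc n)) ≗ U r n
contract-U r n X rewrite ∣⊥∣≡0 n = refl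

U-contractions : ∀ r n t → IsMinor (U r n) (U (t + r) (t + n))
U-contractions r n zero = same (λ _ → refl)
U-contractions r n (suc t) =
  con zero (IsMinor-respʳ (U-contractions r n t) (λ X → sym (contract-U (t + r) (t + n) X)))

U-deletions : ∀ r n s → IsMinor (U r n) (U r (s + n))
U-deletions r n zero = same (λ _ → refl)
U-deletions r n (suc s) = del zero (U-deletions r n s)

U-minor : ∀ {r₀ n₀ r n} → r₀ ≤ r → (r ∸ r₀) + n₀ ≤ n → IsMinor (U r₀ n₀) (U r n)
U-minor {r₀} {n₀} {r} {n} r₀≤r t+n₀≤n =
  subst₂ (λ r′ n′ → IsMinor (U r₀ n₀) (U r′ n′)) (m∸n+n≡m r₀≤r) (m∸n+n≡m t+n₀≤n)
    (IsMinor-trans (U-contractions r₀ n₀ t) (U-deletions (t + r₀) (t + n₀) (n ∸ (t + n₀))))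
  where
  t : ℕ
  t = r ∸ r₀

≗⇒Isomorphic : ∀ {n} {N M : SetFn n} → N ≗ M → Isomorphic N M
≗⇒Isomorphic {M = M} N≗M = idₚ , λ X → trans (cong M (tabulate∘lookup X)) (sym (N≗M X))

Isomorphic-replicate : ∀ {n} {N M : SetFn n} → Isomorphic N M → ∀ s → N (replicate n s) ≡ M (replicate n s)
Isomorphic-replicate {M = M} (π , iso) s = trans (sym (iso _)) (cong M (image-replicate π s))

U-HasMinorIso-U : ∀ {r₀ n₀ r n} → r₀ ≤ r → (r ∸ r₀) + n₀ ≤ n → HasMinorIso (U r n) (U r₀ n₀)
U-HasMinorIso-U r₀≤r t+n₀≤n = U _ _ , U-minor r₀≤r t+n₀≤n , ≗⇒Isomorphic (λ _ → refl)

RankAtMost : ℕ → ∀ {n} → SetFn n → Set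
RankAtMost c M = ∀ X → M X ≤ c

-- For a matroid this says that its dual has rank at most c; the relative form
-- over all pairs X ⊆ Y is what survives deletion and contraction.
record CorankAtMost (c : ℕ) {n : ℕ} (M : SetFn n) : Set where
  field
    monotone : ∀ X Y → X ⊆ Y → M X ≤ M Y
    nullity  : ∀ X Y → X ⊆ Y → ∣ Y ∣ ∸ ∣ X ∣ ≤ (M Y ∸ M X) + c

rankAtMost-minorClosed : ∀ c → MinorClosed (RankAtMost c)
rankAtMost-minorClosed c = minorClosed (RankAtMost c)
  (λ M≗M′ rk X → subst (_≤ c) (M≗M′ X) (rk X))
  (λ e M rk X → rk _)
  (λ e M rk X → ≤-trans (m∸n≤m _ (M ⁅ e ⁆)) (rk _))

corankAtMost-minorClosed : ∀ c → MinorClosed (CorankAtMost c)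
corankAtMost-minorClosed c = minorClosed (CorankAtMost c) ≗-pres delete-pres contract-pres
  where
  ≗-pres : ∀ {n} {M M′ : SetFn n} → M ≗ M′ → CorankAtMost c M → CorankAtMost c M′
  ≗-pres M≗M′ ck = record
    { monotone = λ X Y X⊆Y → subst₂ _≤_ (M≗M′ X) (M≗M′ Y) (monotone X Y X⊆Y)
    ; nullity  = λ X Y X⊆Y →
        subst (λ z → ∣ Y ∣ ∸ ∣ X ∣ ≤ z + c) (cong₂ _∸_ (M≗M′ Y) (M≗M′ X)) (nullity X Y X⊆Y)
    }
    where open CorankAtMost ck
  delete-pres : ∀ {n} (e : Fin (suc n)) M → CorankAtMost c M → CorankAtMost c (delete e M)
  delete-pres e M ck = record
    { monotone = λ X Y X⊆Y → monotone _ _ (insertAt-mono-⊆ e outside X⊆Y)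
    ; nullity  = λ X Y X⊆Y →
        subst (_≤ (M (insertAt Y e outside) ∸ M (insertAt X e outside)) + c)
          (cong₂ _∸_ (∣insertAt-outside∣≡∣p∣ Y e) (∣insertAt-outside∣≡∣p∣ X e))
          (nullity _ _ (insertAt-mono-⊆ e outside X⊆Y))
    }
    where open CorankAtMost ck
  -- Monotonicity gives M ⁅ e ⁆ ≤ M (X + e), so subtracting M ⁅ e ⁆ does not truncate.
  contract-pres : ∀ {n} (e : Fin (suc n)) M → CorankAtMost c M → CorankAtMost c (contract e M)
  contract-pres e M ck = record
    { monotone = λ X Y X⊆Y → ∸-monoˡ-≤ (M ⁅ e ⁆) (monotone _ _ (insertAt-mono-⊆ e inside X⊆Y))
    ; nullity  = λ X Y X⊆Y →
        subst₂ (λ z w → z ≤ w + c)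
          (cong₂ _∸_ (∣insertAt-inside∣≡1+∣p∣ Y e) (∣insertAt-inside∣≡1+∣p∣ X e))
          (sym (trans (∸-+-assoc _ (M ⁅ e ⁆) _)
                      (cong (M (insertAt Y e inside) ∸_)
                            (m+[n∸m]≡n (monotone _ _ (⁅i⁆⊆insertAt-inside X e))))))
          (nullity _ _ (insertAt-mono-⊆ e inside X⊆Y))
    }
    where open CorankAtMost ck

U-rankAtMost : ∀ r n → RankAtMost r (U r n)
U-rankAtMost r n X = m⊓n≤n ∣ X ∣ r

U-corankAtMost : ∀ r n → CorankAtMost (n ∸ r) (U r n)
U-corankAtMost r n = record
  { monotone = λ X Y X⊆Y → ⊓-monoˡ-≤ r (p⊆q⇒∣p∣≤∣q∣ X⊆Y)
  ; nullity  = λ X Y X⊆Y → ⊓-nullity-bound r n (p⊆q⇒∣p∣≤∣q∣ X⊆Y) (∣p∣≤n Y)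
  }

Isomorphic-U-⊤ : ∀ {r b} {L : SetFn b} → Isomorphic L (U r b) → r ≤ b → L ⊤ ≡ r
Isomorphic-U-⊤ {r} {b} L≅U r≤b =
  trans (Isomorphic-replicate {M = U r b} L≅U inside) (trans (cong (_⊓ r) (∣⊤∣≡n b)) (m≥n⇒m⊓n≡n r≤b))

Isomorphic-U-⊥ : ∀ {r b} {L : SetFn b} → Isomorphic L (U r b) → L ⊥ ≡ 0
Isomorphic-U-⊥ {r} {b} L≅U = trans (Isomorphic-replicate {M = U r b} L≅U outside) (cong (_⊓ r) (∣⊥∣≡0 b))

rankAtMost⇒¬HasMinorIso-U : ∀ {c r b n} {M : SetFn n} →
  RankAtMost c M → c < r → r ≤ b → ¬ HasMinorIso M (U r b)
rankAtMost⇒¬HasMinorIso-U {c} rk c<r r≤b (L , L≼M , L≅U) =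
  <⇒≱ c<r (subst (_≤ c) (Isomorphic-U-⊤ L≅U r≤b) (rankAtMost-minorClosed c L≼M rk ⊤))

corankAtMost⇒¬HasMinorIso-U : ∀ {c r b n} {M : SetFn n} →
  CorankAtMost c M → c + r < b → r ≤ b → ¬ HasMinorIso M (U r b)
corankAtMost⇒¬HasMinorIso-U {c} {r} {b} ck c+r<b r≤b (L , L≼M , L≅U) =
  <⇒≱ c+r<b (subst₂ _≤_ (cong₂ _∸_ (∣⊤∣≡n b) (∣⊥∣≡0 b)) L⊤∸L⊥+c≡c+r
                         (CorankAtMost.nullity (corankAtMost-minorClosed c L≼M ck) ⊥ ⊤ ⊥⊆))
  where
  L⊤∸L⊥+c≡c+r : (L ⊤ ∸ L ⊥) + c ≡ c + r
  L⊤∸L⊥+c≡c+r = trans (cong (_+ c) (cong₂ _∸_ (Isomorphic-U-⊤ L≅U r≤b) (Isomorphic-U-⊥ L≅U))) (+-comm r c)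

HasMinorIso-respˡ : ∀ {m n} {M M′ : SetFn n} {N : SetFn m} → M ≗ M′ → HasMinorIso M N → HasMinorIso M′ N
HasMinorIso-respˡ M≗M′ (L , L≼M , L≅N) = L , IsMinor-respʳ L≼M M≗M′ , L≅N

InC-resp : ∀ {a b n} {M M′ : SetFn n} → M ≗ M′ → InC a b M → InC a b M′
InC-resp {a} {b} {M = M} {M′} M≗M′ (isM , ¬A , ¬B) =
  IsMatroid-resp M≗M′ isM , (λ h → ¬A (HasMinorIso-respˡ {N = U a b} M′≗M h))
                          , (λ h → ¬B (HasMinorIso-respˡ {N = U (b ∸ a) b} M′≗M h))
  where
  M′≗M : M′ ≗ M
  M′≗M X = sym (M≗M′ X)

U-InC : ∀ {a b m n} → a ≤ b ∸ a → m < a ⊎ n ∸ m < a → InC a b (U m n)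
U-InC {a} {b} {m} {n} a≤d small = U-isMatroid m n , excluded small
  where
  d : ℕ
  d = b ∸ a
  a≤b : a ≤ b
  a≤b = ≤-trans a≤d (m∸n≤m b a)
  excluded : m < a ⊎ n ∸ m < a → ¬ HasMinorIso (U m n) (U a b) × ¬ HasMinorIso (U m n) (U d b)
  excluded (inj₁ m<a) =
      rankAtMost⇒¬HasMinorIso-U (U-rankAtMost m n) m<a a≤b
    , rankAtMost⇒¬HasMinorIso-U (U-rankAtMost m n) (<-≤-trans m<a a≤d) (m∸n≤m b a)
  excluded (inj₂ c<a) =
      corankAtMost⇒¬HasMinorIso-U (U-corankAtMost m n)
        (<-≤-trans (+-monoˡ-< a c<a) (≤-trans (+-monoˡ-≤ a a≤d) (≤-reflexive (m∸n+n≡m a≤b)))) a≤b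
    , corankAtMost⇒¬HasMinorIso-U (U-corankAtMost m n)
        (<-≤-trans (+-monoˡ-< d c<a) (≤-reflexive (m+[n∸m]≡n a≤b))) (m∸n≤m b a)

U-¬InC : ∀ {a b m n} → a ≤ b → a ≤ m → m + a ≤ n → 2 * (b ∸ a) ≤ n → ¬ InC a b (U m n)
U-¬InC {a} {b} {m} {n} a≤b a≤m m+a≤n 2d≤n (_ , ¬A , ¬D) with b ∸ a ≤? m
... | yes d≤m = ¬D (U-HasMinorIso-U d≤m (≤-trans (≤-reflexive [m∸d]+b≡m+a) m+a≤n))
  where
  open ≡-Reasoning
  d : ℕ
  d = b ∸ a
  [m∸d]+b≡m+a : (m ∸ d) + b ≡ m + a
  [m∸d]+b≡m+a = begin
    (m ∸ d) + b        ≡⟨ cong ((m ∸ d) +_) (sym (m∸n+n≡m a≤b)) ⟩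
    (m ∸ d) + (d + a)  ≡⟨ sym (+-assoc (m ∸ d) d a) ⟩
    (m ∸ d) + d + a    ≡⟨ cong (_+ a) (m∸n+n≡m d≤m) ⟩
    m + a              ∎
... | no d≰m = ¬A (U-HasMinorIso-U a≤m (<⇒≤ [m∸a]+b<n))
  where
  open ≤-Reasoning
  d : ℕ
  d = b ∸ a
  [m∸a]+b<n : (m ∸ a) + b < n
  [m∸a]+b<n = begin-strict
    (m ∸ a) + b        ≡⟨ cong ((m ∸ a) +_) (sym (m+[n∸m]≡n a≤b)) ⟩
    (m ∸ a) + (a + d)  ≡⟨ sym (+-assoc (m ∸ a) a d) ⟩
    (m ∸ a) + a + d    ≡⟨ cong (_+ d) (m∸n+n≡m a≤m) ⟩
    m + d              <⟨ +-monoˡ-< d (≰⇒> d≰m) ⟩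
    d + d              ≡⟨ cong (d +_) (sym (+-identityʳ d)) ⟩
    2 * d              ≤⟨ 2d≤n ⟩
    n                  ∎

blowUp-replicate : ∀ k {n} (s : Side) → blowUp k (replicate n s) ≡ replicate (n * k) s
blowUp-replicate k {n} = tabulate-lookup-replicate {n = n} (λ z → proj₁ (remQuot k z))

naturalMatroid-one-element : ∀ k (ρ : SetFn 1) → ρ ⊥ ≡ 0 → naturalMatroid k ρ ≗ U (ρ ⁅ zero ⁆) (1 * k)
naturalMatroid-one-element k ρ ρ⊥≡0 Z = begin
  (ρ ⊥ + ∣ Z ∩ ∁ (blowUp k (⊥ {1})) ∣) ⊓ (m + ∣ Z ∩ ∁ (blowUp k (⊤ {1})) ∣)
    ≡⟨ cong₂ (λ x y → (ρ ⊥ + x) ⊓ (m + y)) (∣Z∖blowUp∣ outside) (∣Z∖blowUp∣ inside) ⟩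
  (ρ ⊥ + ∣ Z ∩ ⊤ ∣) ⊓ (m + ∣ Z ∩ ⊥ ∣)
    ≡⟨ cong₂ _⊓_ (cong₂ _+_ ρ⊥≡0 (cong ∣_∣ (∩-identityʳ Z)))
                 (cong (m +_) (trans (cong ∣_∣ (∩-zeroʳ Z)) (∣⊥∣≡0 (1 * k)))) ⟩
  ∣ Z ∣ ⊓ (m + 0)
    ≡⟨ cong (∣ Z ∣ ⊓_) (+-identityʳ m) ⟩
  ∣ Z ∣ ⊓ m ∎
  where
  open ≡-Reasoning
  m : ℕ
  m = ρ ⁅ zero ⁆
  ∣Z∖blowUp∣ : ∀ s → ∣ Z ∩ ∁ (blowUp k (replicate 1 s)) ∣ ≡ ∣ Z ∩ replicate (1 * k) (not s) ∣
  ∣Z∖blowUp∣ s = trans (cong (λ A → ∣ Z ∩ ∁ A ∣) (blowUp-replicate k s))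
                        (cong (λ A → ∣ Z ∩ A ∣) (map-replicate not s (1 * k)))

minor-on-∅-normalized : (ρ : SetFn 1) {N : SetFn 0} → ρ ⊥ ≡ 0 → IsMinor N ρ → N [] ≡ 0
minor-on-∅-normalized ρ ρ⊥≡0 (del zero (same N≗ρ\e)) = trans (N≗ρ\e []) ρ⊥≡0
minor-on-∅-normalized ρ ρ⊥≡0 (con zero (same N≗ρ/e)) = trans (N≗ρ/e []) (n∸n≡0 (ρ ⁅ zero ⁆))

InCk-on-∅ : ∀ a b k {N : SetFn 0} → 1 ≤ b → N [] ≡ 0 → InCk a b k N
InCk-on-∅ a b k {N} 1≤b N∅≡0 = (isPolymatroid , λ ()) , isMatroid , noUniformMinor a , noUniformMinor (b ∸ a)
  where
  isPolymatroid : IsPolymatroid N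
  isPolymatroid = record
    { normalized = N∅≡0
    ; monotone   = λ { [] [] _ → ≤-refl }
    ; submodular = λ { [] [] → ≤-refl }
    }
  isMatroid : IsMatroid (naturalMatroid k N)
  isMatroid = record
    { bounded    = λ { [] → ≤-reflexive (trans (+-identityʳ (N [])) N∅≡0) }
    ; monotone   = λ { [] [] _ → ≤-refl }
    ; submodular = λ { [] [] → ≤-refl }
    }
  noUniformMinor : ∀ r → ¬ HasMinorIso (naturalMatroid k N) (U r b)
  noUniformMinor r (_ , L≼M , _) with ≤-trans 1≤b (IsMinor⇒≤ L≼M)
  ... | ()

single : ℕ → SetFn 1
single m (outside ∷ []) = 0
single m (inside ∷ []) = m

single-isKPolymatroid : ∀ {m k} → m ≤ k → IsKPolymatroid k (single m)
single-isKPolymatroid {m} m≤k = isPolymatroid , λ { zero → m≤k }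
  where
  isPolymatroid : IsPolymatroid (single m)
  isPolymatroid = record
    { normalized = refl
    ; monotone   = λ { (outside ∷ []) _ _ → z≤n
                     ; (inside ∷ []) (inside ∷ []) _ → ≤-refl
                     ; (inside ∷ []) (outside ∷ []) X⊆Y → case X⊆Y here of λ () }
    ; submodular = λ { (outside ∷ []) (outside ∷ []) → ≤-refl
                     ; (outside ∷ []) (inside ∷ []) → ≤-reflexive (+-identityʳ m)
                     ; (inside ∷ []) (outside ∷ []) → ≤-refl
                     ; (inside ∷ []) (inside ∷ []) → ≤-refl }
    }

single-Isomorphic : (ρ : SetFn 1) → ρ ⊥ ≡ 0 → Isomorphic ρ (single (ρ ⁅ zero ⁆))
single-Isomorphic ρ ρ⊥≡0 = ≗⇒Isomorphic {M = single (ρ ⁅ zero ⁆)} λ { (outside ∷ []) → ρ⊥≡0 ; (inside ∷ []) → refl }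

Isomorphic-single⇒≡ : ∀ {m n} → Isomorphic (single m) (single n) → m ≡ n
Isomorphic-single⇒≡ {m} {n} m≅n = Isomorphic-replicate {M = single n} m≅n inside

k∸2a≡k∸a∸a : ∀ k a → k ∸ 2 * a ≡ k ∸ a ∸ a
k∸2a≡k∸a∸a k a = trans (cong (λ x → k ∸ (a + x)) (+-identityʳ a)) (sym (∸-+-assoc k a a))

shifted-index-≤ : ∀ {a k} → a ≤ k ∸ a → (i : Fin (k ∸ 2 * a + 1)) → a + toℕ i ≤ k ∸ a
shifted-index-≤ {a} {k} a≤k∸a i = begin
  a + toℕ i          ≤⟨ +-monoʳ-≤ a (m<1+n⇒m≤n (subst (toℕ i <_) (+-comm (k ∸ 2 * a) 1) (toℕ<n i))) ⟩
  a + (k ∸ 2 * a)    ≡⟨ cong (a +_) (k∸2a≡k∸a∸a k a) ⟩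
  a + (k ∸ a ∸ a)    ≡⟨ m+[n∸m]≡n a≤k∸a ⟩
  k ∸ a              ∎
  where open ≤-Reasoning

shifted-rank-< : ∀ {a k m} → m ≤ k ∸ a → m ∸ a < k ∸ 2 * a + 1
shifted-rank-< {a} {k} {m} m≤k∸a = subst (m ∸ a <_) (+-comm 1 (k ∸ 2 * a))
  (s≤s (subst (m ∸ a ≤_) (sym (k∸2a≡k∸a∸a k a)) (∸-monoˡ-≤ a m≤k∸a)))

module _ {a b k : ℕ} (1≤b : 1 ≤ b) (2a≤b : 2 * a ≤ b) (2d≤k : 2 * (b ∸ a) ≤ k) where

  private
    a≤b∸a : a ≤ b ∸ a
    a≤b∸a = m+n≤o⇒m≤o∸n a (subst (_≤ b) (cong (a +_) (+-identityʳ a)) 2a≤b)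

    a≤b : a ≤ b
    a≤b = ≤-trans a≤b∸a (m∸n≤m b a)

    a≤k∸a : a ≤ k ∸ a
    a≤k∸a = m+n≤o⇒m≤o∸n a (≤-trans (+-mono-≤ a≤b∸a a≤b∸a)
                                    (subst (_≤ k) (cong (b ∸ a +_) (+-identityʳ (b ∸ a))) 2d≤k))

    a≤k : a ≤ k
    a≤k = ≤-trans a≤k∸a (m∸n≤m k a)

    1*k≡k : 1 * k ≡ k
    1*k≡k = *-identityˡ k

  InCk-of-rank-outside : (ρ : SetFn 1) → IsKPolymatroid k ρ →
    ρ ⁅ zero ⁆ < a ⊎ k ∸ a + 1 ≤ ρ ⁅ zero ⁆ → InCk a b k ρ
  InCk-of-rank-outside ρ kp outside-range =
    kp , InC-resp (λ Z → sym (naturalMatroid-one-element k ρ ρ⊥≡0 Z)) (U-InC a≤b∸a (corank-small outside-range))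
    where
    m : ℕ
    m = ρ ⁅ zero ⁆
    ρ⊥≡0 : ρ ⊥ ≡ 0
    ρ⊥≡0 = IsPolymatroid.normalized (proj₁ kp)
    -- k ∸ m < k ∸ (k ∸ a) = a, since k ∸ a < m ≤ k.
    corank-small : m < a ⊎ k ∸ a + 1 ≤ m → m < a ⊎ 1 * k ∸ m < a
    corank-small (inj₁ m<a) = inj₁ m<a
    corank-small (inj₂ k∸a<m) = inj₂ (subst (_< a) (cong (_∸ m) (sym 1*k≡k))
      (subst (k ∸ m <_) (m∸[m∸n]≡n a≤k)
        (∸-monoʳ-< (subst (_≤ m) (+-comm (k ∸ a) 1) k∸a<m) (proj₂ kp zero))))

  IsExcluded-of-rank-inside : (ρ : SetFn 1) → IsKPolymatroid k ρ →
    a ≤ ρ ⁅ zero ⁆ → ρ ⁅ zero ⁆ ≤ k ∸ a → IsExcluded a b k ρ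
  IsExcluded-of-rank-inside ρ kp a≤m m≤k∸a = kp , ¬InCk , properMinorsInCk
    where
    m : ℕ
    m = ρ ⁅ zero ⁆
    ρ⊥≡0 : ρ ⊥ ≡ 0
    ρ⊥≡0 = IsPolymatroid.normalized (proj₁ kp)
    ¬InCk : ¬ InCk a b k ρ
    ¬InCk (_ , inC) =
      U-¬InC a≤b a≤m (subst (m + a ≤_) (sym 1*k≡k) (m≤o∸n⇒m+n≤o m a≤k m≤k∸a))
        (subst (2 * (b ∸ a) ≤_) (sym 1*k≡k) 2d≤k)
        (InC-resp (naturalMatroid-one-element k ρ ρ⊥≡0) inC)
    properMinorsInCk : ∀ {n} (N : SetFn n) → IsProperMinor N ρ → InCk a b k N
    properMinorsInCk N (N≼ρ , s≤s z≤n) = InCk-on-∅ a b k 1≤b (minor-on-∅-normalized ρ ρ⊥≡0 N≼ρ)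

  IsExcluded⇒rank-inside : (ρ : SetFn 1) → IsExcluded a b k ρ → a ≤ ρ ⁅ zero ⁆ × ρ ⁅ zero ⁆ ≤ k ∸ a
  IsExcluded⇒rank-inside ρ (kp , ¬InCk , _) with ρ ⁅ zero ⁆ <? a | k ∸ a + 1 ≤? ρ ⁅ zero ⁆
  ... | yes m<a | _ = ⊥-elim (¬InCk (InCk-of-rank-outside ρ kp (inj₁ m<a)))
  ... | no _ | yes k∸a<m = ⊥-elim (¬InCk (InCk-of-rank-outside ρ kp (inj₂ k∸a<m)))
  ... | no m≮a | no k∸a≮m =
    ≮⇒≥ m≮a , m<1+n⇒m≤n (subst (ρ ⁅ zero ⁆ <_) (+-comm (k ∸ a) 1) (≰⇒> k∸a≮m))

  single-shifted-isExcluded : (i : Fin (k ∸ 2 * a + 1)) → IsExcluded a b k (single (a + toℕ i))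
  single-shifted-isExcluded i = IsExcluded-of-rank-inside (single (a + toℕ i))
    (single-isKPolymatroid (≤-trans a+i≤k∸a (m∸n≤m k a))) (m≤m+n a (toℕ i)) a+i≤k∸a
    where
    a+i≤k∸a : a + toℕ i ≤ k ∸ a
    a+i≤k∸a = shifted-index-≤ a≤k∸a i

  IsExcluded⇒Isomorphic-single-shifted : (ρ : SetFn 1) → IsExcluded a b k ρ →
    Σ (Fin (k ∸ 2 * a + 1)) (λ i → Isomorphic ρ (single (a + toℕ i)))
  IsExcluded⇒Isomorphic-single-shifted ρ ex@((isPolymatroid , _) , _) =
    fromℕ< m∸a<size
    , subst (λ x → Isomorphic ρ (single x)) m≡a+i (single-Isomorphic ρ (IsPolymatroid.normalized isPolymatroid))
    where
    a≤m : a ≤ ρ ⁅ zero ⁆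
    a≤m = proj₁ (IsExcluded⇒rank-inside ρ ex)
    m∸a<size : ρ ⁅ zero ⁆ ∸ a < k ∸ 2 * a + 1
    m∸a<size = shifted-rank-< {a} {k} (proj₂ (IsExcluded⇒rank-inside ρ ex))
    m≡a+i : ρ ⁅ zero ⁆ ≡ a + toℕ (fromℕ< m∸a<size)
    m≡a+i = sym (trans (cong (a +_) (toℕ-fromℕ< m∸a<size)) (m+[n∸m]≡n a≤m))

mainTheorem2 : (a b k : ℕ) → 1 ≤ b → 2 * a ≤ b → 2 * (b ∸ a) ≤ k →
    ((ρ : SetFn 1) → IsKPolymatroid k ρ →
      ((ρ ⁅ zero ⁆ < a ⊎ k ∸ a + 1 ≤ ρ ⁅ zero ⁆) → InCk a b k ρ × ¬ IsExcluded a b k ρ)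
      × (a ≤ ρ ⁅ zero ⁆ → ρ ⁅ zero ⁆ ≤ k ∸ a → IsExcluded a b k ρ))
    × Σ (Fin (k ∸ 2 * a + 1) → SetFn 1) (λ f →
        (∀ i → IsExcluded a b k (f i))
        × (∀ i j → Isomorphic (f i) (f j) → i ≡ j)
        × ((ρ : SetFn 1) → IsExcluded a b k ρ → Σ (Fin (k ∸ 2 * a + 1)) (λ i → Isomorphic ρ (f i))))
mainTheorem2 a b k 1≤b 2a≤b 2d≤k =
  (λ ρ kp → (λ outside-range → let inCk = InCk-of-rank-outside 1≤b 2a≤b 2d≤k ρ kp outside-range
                               in inCk , λ (_ , ¬InCk , _) → ¬InCk inCk)
          , IsExcluded-of-rank-inside 1≤b 2a≤b 2d≤k ρ kp)
  , (λ i → single (a + toℕ i))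
  , single-shifted-isExcluded 1≤b 2a≤b 2d≤k
  , (λ i j i≅j → toℕ-injective (+-cancelˡ-≡ a (toℕ i) (toℕ j) (Isomorphic-single⇒≡ i≅j)))
  , IsExcluded⇒Isomorphic-single-shifted 1≤b 2a≤b 2d≤k
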